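{- Let $T$ be a free tree with vertex set $V$. Then a planar arrangement of $T$ of maximum cost is also a projective arrangement of maximum cost of $T$ rooted at some vertex $u\in V$, and $$D^{\mathrm{pl}}_{\max}(T)=\max_{u\in V} D^{\mathrm{pr}}_{\max}(T^u).$$
   Context: A linear arrangement of a graph $G=(V,E)$ with $n=|V|$ is a bijection $\pi:V\to\{1,\dots,n\}$; the cost of $\pi$ is $\sum_{uv\in E}|\pi(u)-\pi(v)|$. Two edges $st,uv$ with $\pi(s)<\pi(t)$, $\pi(u)<\pi(v)$, $\pi(s)<\pi(u)$ cross if $\pi(s)<\pi(u)<\pi(t)<\pi(v)$; an arrangement is planar if no two edges cross. $D^{\mathrm{pl}}_{\max}(T)$ is the maximum cost over all planar arrangements of the free tree $T$. For $u\in V$, $T^u$ denotes $T$ rooted at $u$; an arrangement of $T^u$ is projective if it is planar and there is no edge $xy$ with $\min(\pi(x),\pi(y))<\pi(u)<\max(\pi(x),\pi(y))$, and $D^{\mathrm{pr}}_{\max}(T^u)$ is the maximum cost over all projective arrangements of $T^u$. -}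

module Defs where

open import Data.Nat using (ℕ; suc; _∸_; _<_; _≤_; ∣_-_∣)
open import Data.Nat.Base using (_⊓_; _⊔_)
open import Data.Fin using (Fin; toℕ)
open import Data.Fin.Permutation using (Permutation′; _⟨$⟩ʳ_)
open import Data.List using (List; length; map)
open import Data.Nat.ListAction using (sum)
open import Data.List.Membership.Propositional using (_∈_)
open import Data.Product using (_×_; _,_; Σ; ∃)
open import Relation.Nullary using (¬_)
open import Relation.Binary.PropositionalEquality using (_≡_)

-- A graph on vertex set Fin n, given by its list of (undirected) edges.
Edge : ℕ → Set
Edge n = Fin n × Fin n

data Reach {n : ℕ} (E : List (Edge n)) : Fin n → Fin n → Set where
  here  : ∀ {x} → Reach E x x
  fwd   : ∀ {x y z} → (x , y) ∈ E → Reach E y z → Reach E x z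
  bwd   : ∀ {x y z} → (y , x) ∈ E → Reach E y z → Reach E x z

Connected : ∀ {n} → List (Edge n) → Set
Connected {n} E = ∀ (x y : Fin n) → Reach E x y

IsTree : ∀ {n} → List (Edge n) → Set
IsTree {n} E = (0 < n) × Connected E × (length E ≡ n ∸ 1)

-- Linear arrangement: bijection V → positions (0-based positions Fin n).
Arrangement : ℕ → Set
Arrangement n = Permutation′ n

pos : ∀ {n} → Arrangement n → Fin n → ℕ
pos π v = toℕ (π ⟨$⟩ʳ v)

cost : ∀ {n} → List (Edge n) → Arrangement n → ℕ
cost E π = sum (map (λ e → ∣ pos π (Data.Product.proj₁ e) - pos π (Data.Product.proj₂ e) ∣) E)

lo hi : ∀ {n} → Arrangement n → Edge n → ℕ
lo π (x , y) = pos π x ⊓ pos π y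
hi π (x , y) = pos π x ⊔ pos π y

Cross : ∀ {n} → Arrangement n → Edge n → Edge n → Set
Cross π e f = (lo π e < lo π f) × (lo π f < hi π e) × (hi π e < hi π f)

Planar : ∀ {n} → List (Edge n) → Arrangement n → Set
Planar E π = ∀ e f → e ∈ E → f ∈ E → ¬ Cross π e f

Projective : ∀ {n} → List (Edge n) → Fin n → Arrangement n → Set
Projective E u π =
  Planar E π × (∀ e → e ∈ E → ¬ ((lo π e < pos π u) × (pos π u < hi π e)))

MaxPlanar : ∀ {n} → List (Edge n) → Arrangement n → Set
MaxPlanar E π = Planar E π × (∀ σ → Planar E σ → cost E σ ≤ cost E π)

MaxProjective : ∀ {n} → List (Edge n) → Fin n → Arrangement n → Set
MaxProjective E u π =
  Projective E u π × (∀ σ → Projective E u σ → cost E σ ≤ cost E π)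

IsDplMax : ∀ {n} → List (Edge n) → ℕ → Set
IsDplMax E d = Σ (Arrangement _) λ π → MaxPlanar E π × (cost E π ≡ d)

IsDprMax : ∀ {n} → List (Edge n) → Fin n → ℕ → Set
IsDprMax E u d = Σ (Arrangement _) λ π → MaxProjective E u π × (cost E π ≡ d)

IsMaxOverRootsDpr : ∀ {n} → List (Edge n) → ℕ → Set
IsMaxOverRootsDpr {n} E d =
  (∃ λ (u : Fin n) → IsDprMax E u d) ×
  (∀ (u : Fin n) d′ → IsDprMax E u d′ → d′ ≤ d)

-- No edge covers the leftmost vertex of an arrangement, so every planar
-- arrangement of T is a projective arrangement of T rooted at its first
-- vertex; conversely every projective arrangement is planar. Hence a
-- planar arrangement of maximum cost is a projective arrangement of
-- maximum cost for that root, and its cost is the maximum of D^pr_max over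
-- all roots. What remains is that the maxima exist: there are finitely
-- many arrangements, and a tree has a planar one, obtained from a planar
-- arrangement of the tree minus a leaf by placing the leaf right next to
-- its neighbour.
module Submission where

open import Defs
open import Data.Nat using (ℕ)
open import Data.Fin using (Fin)
open import Data.List using (List)
open import Data.Product using (_×_; Σ; ∃)

open import Data.Bool using (if_then_else_)
open import Data.Empty using (⊥-elim)
open import Data.Fin using (toℕ; zero; suc; _≟_; punchIn; punchOut)
open import Data.Fin.Permutation
  using (_⟨$⟩ʳ_; _⟨$⟩ˡ_; _≈_; permutation; inverseʳ; inverseˡ; insert; insert-punchIn)
import Data.Fin.Permutation as Permutation
open import Data.Fin.Properties
  using (all?; ¬∀⟶∃¬; punchInᵢ≢i; punchIn-punchOut; punchOut-punchIn; punchOut-cong)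
open import Data.List using ([]; _∷_; _++_; length; map; filter; concat; allFin; cartesianProductWith)
open import Data.List.Extrema.Nat using (argmax; argmax-all; f[xs]≤f[argmax])
open import Data.List.Membership.Propositional using (_∈_)
open import Data.List.Membership.Propositional.Properties
  using (∈-allFin; ∈-cartesianProductWith⁺; ∈-concat⁺′; ∈-filter⁺; ∈-map⁺; ∈-++⁻; ∈-++⁺ˡ; ∈-++⁺ʳ)
open import Data.List.Properties using (map-cong; length-map; length-++)
open import Data.List.Relation.Unary.All using (All; []; _∷_)
import Data.List.Relation.Unary.All as All
open import Data.List.Relation.Unary.All.Properties using (all-filter; ++⁺)
open import Data.List.Relation.Unary.Any using (here; there)
open import Data.Nat using (zero; suc; _+_; _*_; _≤_; _<_; _⊓_; _⊔_; _≤?_; _<?_; ∣_-_∣; z≤n; s≤s; s≤s⁻¹)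
open import Data.Nat.ListAction using (sum)
open import Data.Nat.Properties
  using (+-0-monoid; +-0-commutativeMonoid; <⇒≱; ≮⇒≥; ≰⇒>; n≮0; m≤m+n; m≤n+m; +-mono-≤; +-suc; suc-injective;
         m+n≡0⇒m≡0; m+n≡0⇒n≡0; n≤0⇒n≡0; m+n≤o⇒m≤o; m+n≤o⇒n≤o;
         mono-≤-distrib-⊓; mono-≤-distrib-⊔; module ≤-Reasoning)
open import Algebra.Properties.CommutativeMonoid.Sum +-0-commutativeMonoid using (∑-distrib-+)
open import Algebra.Properties.Monoid.Sum +-0-monoid using (sum-syntax; sum-replicate-zero)
open import Data.Product using (_,_; proj₁; proj₂)
import Data.Vec.Functional as Vector
open import Data.Sum using (_⊎_; inj₁; inj₂)
open import Function using (_∘_)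
open import Relation.Binary.Core using (_Preserves_⟶_)
open import Relation.Binary.PropositionalEquality
  using (_≡_; _≢_; refl; sym; trans; cong; cong₂; subst; subst₂; module ≡-Reasoning)
open import Relation.Nullary using (¬_; Dec; yes; no; does; ¬?)
open import Relation.Nullary.Decidable using (_×-dec_; map′; dec-true; dec-yes)

Crossing : ℕ → ℕ → ℕ → ℕ → Set
Crossing a b c d = (a ⊓ b < c ⊓ d) × (c ⊓ d < a ⊔ b) × (a ⊔ b < c ⊔ d)

Crossing-cong : ∀ {a b c d a′ b′ c′ d′} →
  a ≡ a′ → b ≡ b′ → c ≡ c′ → d ≡ d′ → Crossing a b c d → Crossing a′ b′ c′ d′
Crossing-cong refl refl refl refl crossing = crossing

Crossing-reflect : ∀ {f : ℕ → ℕ} → f Preserves _≤_ ⟶ _≤_ →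
  ∀ a b c d → Crossing (f a) (f b) (f c) (f d) → Crossing a b c d
Crossing-reflect {f} mono a b c d (x , y , z)
  rewrite sym (mono-≤-distrib-⊓ mono a b) | sym (mono-≤-distrib-⊓ mono c d)
        | sym (mono-≤-distrib-⊔ mono a b) | sym (mono-≤-distrib-⊔ mono c d)
  = reflect-< x , reflect-< y , reflect-< z
  where
  reflect-< : ∀ {m n} → f m < f n → m < n
  reflect-< {m} {n} fm<fn with m <? n
  ... | yes m<n = m<n
  ... | no m≮n = ⊥-elim (<⇒≱ fm<fn (mono (≮⇒≥ m≮n)))

Adjacent : ℕ → ℕ → Set
Adjacent a b = a ⊔ b ≡ suc (a ⊓ b)

adjacentˡ : ∀ p → Adjacent (suc p) p
adjacentˡ zero = refl
adjacentˡ (suc p) = cong suc (adjacentˡ p)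

adjacentʳ : ∀ p → Adjacent p (suc p)
adjacentʳ zero = refl
adjacentʳ (suc p) = cong suc (adjacentʳ p)

¬Crossing-adjacentˡ : ∀ {a b} c d → Adjacent a b → ¬ Crossing a b c d
¬Crossing-adjacentˡ {a} {b} c d adj (x , y , _) =
  <⇒≱ x (s≤s⁻¹ (subst (c ⊓ d <_) adj y))

¬Crossing-adjacentʳ : ∀ a b {c d} → Adjacent c d → ¬ Crossing a b c d
¬Crossing-adjacentʳ a b {c} {d} adj (_ , y , z) =
  <⇒≱ y (s≤s⁻¹ (subst (a ⊔ b <_) adj z))

module _ {n} {π σ : Arrangement n} (π≈σ : π ≈ σ) where

  pos-cong : ∀ v → pos π v ≡ pos σ v
  pos-cong v = cong toℕ (π≈σ v)

  Planar-resp : (E : List (Edge n)) → Planar E π → Planar E σ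
  Planar-resp E planar (a , b) (c , d) e∈E f∈E crossing = planar (a , b) (c , d) e∈E f∈E
    (Crossing-cong (sym (pos-cong a)) (sym (pos-cong b)) (sym (pos-cong c)) (sym (pos-cong d)) crossing)

  cost-cong : (E : List (Edge n)) → cost E π ≡ cost E σ
  cost-cong E = cong sum (map-cong (λ (a , b) → cong₂ ∣_-_∣ (pos-cong a) (pos-cong b)) E)

-- Finitely many arrangements

functions : ∀ k m → List (Fin k → Fin m)
functions zero m = (λ ()) ∷ []
functions (suc k) m = cartesianProductWith Vector._∷_ (allFin m) (functions k m)

functions-complete : ∀ k m (f : Fin k → Fin m) →
  ∃ λ g → g ∈ functions k m × (∀ i → g i ≡ f i)
functions-complete zero m f = (λ ()) , here refl , λ ()
functions-complete (suc k) m f with functions-complete k m (f ∘ suc)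
... | g , g∈ , g≗f∘suc =
  f zero Vector.∷ g ,
  ∈-cartesianProductWith⁺ _ (∈-allFin (f zero)) g∈ ,
  λ { zero → refl ; (suc i) → g≗f∘suc i }

fromInverses : ∀ {n} (f g : Fin n → Fin n) → List (Arrangement n)
fromInverses f g with all? (λ i → f (g i) ≟ i) | all? (λ i → g (f i) ≟ i)
... | yes f∘g≗id | yes g∘f≗id = permutation f g f∘g≗id g∘f≗id ∷ []
... | _ | _ = []

fromInverses-complete : ∀ {n} (f g : Fin n → Fin n) →
  (∀ i → f (g i) ≡ i) → (∀ i → g (f i) ≡ i) →
  ∃ λ τ → τ ∈ fromInverses f g × (∀ i → τ ⟨$⟩ʳ i ≡ f i)
fromInverses-complete f g f∘g≗id g∘f≗id
  with all? (λ i → f (g i) ≟ i) | all? (λ i → g (f i) ≟ i)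
... | yes _ | yes _ = _ , here refl , λ _ → refl
... | no ¬f∘g≗id | _ = ⊥-elim (¬f∘g≗id f∘g≗id)
... | yes _ | no ¬g∘f≗id = ⊥-elim (¬g∘f≗id g∘f≗id)

arrangements : ∀ n → List (Arrangement n)
arrangements n = concat (cartesianProductWith fromInverses (functions n n) (functions n n))

arrangements-complete : ∀ {n} (σ : Arrangement n) → ∃ λ τ → τ ∈ arrangements n × σ ≈ τ
arrangements-complete {n} σ
  with functions-complete n n (σ ⟨$⟩ʳ_) | functions-complete n n (σ ⟨$⟩ˡ_)
... | f , f∈ , f≗σ | g , g∈ , g≗σ⁻¹
  with fromInverses-complete f g f∘g≗id g∘f≗id
  where
  open ≡-Reasoning
  f∘g≗id : ∀ i → f (g i) ≡ i
  f∘g≗id i = begin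
    f (g i)            ≡⟨ f≗σ (g i) ⟩
    σ ⟨$⟩ʳ g i          ≡⟨ cong (σ ⟨$⟩ʳ_) (g≗σ⁻¹ i) ⟩
    σ ⟨$⟩ʳ (σ ⟨$⟩ˡ i)    ≡⟨ inverseʳ σ ⟩
    i                  ∎
  g∘f≗id : ∀ i → g (f i) ≡ i
  g∘f≗id i = begin
    g (f i)            ≡⟨ g≗σ⁻¹ (f i) ⟩
    σ ⟨$⟩ˡ f i          ≡⟨ cong (σ ⟨$⟩ˡ_) (f≗σ i) ⟩
    σ ⟨$⟩ˡ (σ ⟨$⟩ʳ i)    ≡⟨ inverseˡ σ ⟩
    i                  ∎
... | τ , τ∈ , τ≗f =
  τ , ∈-concat⁺′ τ∈ (∈-cartesianProductWith⁺ fromInverses f∈ g∈) ,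
  λ i → sym (trans (τ≗f i) (f≗σ i))

cross? : ∀ {n} (π : Arrangement n) e f → Dec (Cross π e f)
cross? π (a , b) (c , d) = _ <? _ ×-dec _ <? _ ×-dec _ <? _

planar? : ∀ {n} (E : List (Edge n)) (π : Arrangement n) → Dec (Planar E π)
planar? E π = map′
  (λ none e f e∈E f∈E → All.lookup (All.lookup none e∈E) f∈E)
  (λ planar → All.tabulate λ e∈E → All.tabulate λ f∈E → planar _ _ e∈E f∈E)
  (All.all? (λ e → All.all? (λ f → ¬? (cross? π e f)) E) E)

maxPlanar-exists : ∀ {n} (E : List (Edge n)) →
  Σ (Arrangement n) (Planar E) → Σ (Arrangement n) (MaxPlanar E)
maxPlanar-exists {n} E (σ₀ , planar-σ₀) = best , planar-best , best-maximal
  where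
  candidates : List (Arrangement n)
  candidates = filter (planar? E) (arrangements n)

  best : Arrangement n
  best = argmax (cost E) σ₀ candidates

  planar-best : Planar E best
  planar-best = argmax-all (cost E) planar-σ₀ (all-filter (planar? E) (arrangements n))

  best-maximal : ∀ σ → Planar E σ → cost E σ ≤ cost E best
  best-maximal σ planar-σ with arrangements-complete σ
  ... | τ , τ∈ , σ≈τ = begin
    cost E σ     ≡⟨ cost-cong {π = σ} {σ = τ} σ≈τ E ⟩
    cost E τ     ≤⟨ All.lookup (f[xs]≤f[argmax] {f = cost E} σ₀ candidates)
                      (∈-filter⁺ (planar? E) τ∈ (Planar-resp {π = σ} {σ = τ} σ≈τ E planar-σ)) ⟩
    cost E best  ∎
    where open ≤-Reasoning

-- Degrees and leaves

-- Through `does`, δ (suc a) (suc b) reduces to δ a b, which ∑δ relies on.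
δ : ∀ {n} → Fin n → Fin n → ℕ
δ x y = if does (x ≟ y) then 1 else 0

incidence : ∀ {n} → Fin n → Edge n → ℕ
incidence v (a , b) = δ a v + δ b v

degree : ∀ {n} → List (Edge n) → Fin n → ℕ
degree [] v = 0
degree (e ∷ E) v = incidence v e + degree E v

∑δ : ∀ {n} (a : Fin n) → ∑[ v < n ] δ a v ≡ 1
∑δ {suc n} zero = cong suc (sum-replicate-zero n)
∑δ {suc n} (suc a) = ∑δ a

-- Stated with `length E * 2` so that the step is `2 + _` definitionally.
handshake : ∀ {n} (E : List (Edge n)) → ∑[ v < n ] degree E v ≡ length E * 2
handshake {n} [] = sum-replicate-zero n
handshake {n} ((a , b) ∷ E) = begin
  ∑[ v < n ] (δ a v + δ b v + degree E v)           ≡⟨ ∑-distrib-+ (λ v → δ a v + δ b v) (degree E) ⟩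
  ∑[ v < n ] (δ a v + δ b v) + ∑[ v < n ] degree E v ≡⟨ cong₂ _+_ endpoints (handshake E) ⟩
  2 + length E * 2                                  ∎
  where
  open ≡-Reasoning
  endpoints : ∑[ v < n ] (δ a v + δ b v) ≡ 2
  endpoints = trans (∑-distrib-+ (δ a) (δ b)) (cong₂ _+_ (∑δ a) (∑δ b))

∑-lower-bound : ∀ {n c} (f : Fin n → ℕ) → (∀ v → c ≤ f v) → n * c ≤ ∑[ v < n ] f v
∑-lower-bound {zero} f c≤f = z≤n
∑-lower-bound {suc n} f c≤f = +-mono-≤ (c≤f zero) (∑-lower-bound (f ∘ suc) (c≤f ∘ suc))

degree<2-exists : ∀ {k} (E : List (Edge (suc (suc k)))) → length E ≡ suc k →
  ∃ λ v → degree E v < 2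
degree<2-exists {k} E |E|≡1+k = proj₁ low , ≰⇒> (proj₂ low)
  where
  ¬all-degree≥2 : ¬ (∀ v → 2 ≤ degree E v)
  ¬all-degree≥2 all≥2 = <⇒≱ (m≤n+m (suc (suc k * 2)) 1) (begin
    suc (suc k) * 2           ≤⟨ ∑-lower-bound (degree E) all≥2 ⟩
    ∑[ v < _ ] degree E v     ≡⟨ handshake E ⟩
    length E * 2              ≡⟨ cong (_* 2) |E|≡1+k ⟩
    suc k * 2                 ∎)
    where open ≤-Reasoning
  low : ∃ λ v → ¬ (2 ≤ degree E v)
  low = ¬∀⟶∃¬ _ (λ v → 2 ≤ degree E v) (λ v → 2 ≤? degree E v) ¬all-degree≥2

δ-refl : ∀ {n} (x : Fin n) → δ x x ≡ 1
δ-refl x rewrite dec-true (x ≟ x) refl = refl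

incident-edge : ∀ {n} {E : List (Edge n)} {x z} → Reach E x z → z ≢ x →
  ∃ λ e → e ∈ E × 0 < incidence x e
incident-edge here z≢x = ⊥-elim (z≢x refl)
incident-edge {x = x} (fwd {y = y} xy∈E _) _ =
  (x , y) , xy∈E , subst (_≤ δ x x + δ y x) (δ-refl x) (m≤m+n (δ x x) (δ y x))
incident-edge {x = x} (bwd {y = y} yx∈E _) _ =
  (y , x) , yx∈E , subst (_≤ δ y x + δ x x) (δ-refl x) (m≤n+m (δ x x) (δ y x))

Avoids : ∀ {n} → Fin n → Edge n → Set
Avoids v (a , b) = (a ≢ v) × (b ≢ v)

avoids : ∀ {n} (v : Fin n) e → incidence v e ≡ 0 → Avoids v e
avoids v (a , b) _ with a ≟ v | b ≟ v
avoids v (a , b) _ | no a≢v | no b≢v = a≢v , b≢v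
avoids v (a , b) () | yes _ | _
avoids v (a , b) () | no _ | yes _

Joins : ∀ {n} → Fin n → Fin n → Edge n → Set
Joins u v e = (e ≡ (u , v)) ⊎ (e ≡ (v , u))

joins-once : ∀ {n} (v : Fin n) e → incidence v e ≡ 1 → ∃ λ w → (w ≢ v) × Joins v w e
joins-once v (a , b) _ with a ≟ v | b ≟ v
joins-once v (a , b) _ | yes refl | no b≢v = b , b≢v , inj₁ refl
joins-once v (a , b) _ | no a≢v | yes refl = a , a≢v , inj₂ refl
joins-once v (a , b) () | yes _ | yes _
joins-once v (a , b) () | no _ | no _

module _ {n} (ℓ : Fin n) where

  avoiding : ∀ E → degree E ℓ ≡ 0 → All (Avoids ℓ) E
  avoiding [] _ = []
  avoiding (e ∷ E) deg≡0 =
    avoids ℓ e (m+n≡0⇒m≡0 (incidence ℓ e) deg≡0) ∷ avoiding E (m+n≡0⇒n≡0 (incidence ℓ e) deg≡0)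

  split-at-incident : ∀ E {e} → e ∈ E → 0 < incidence ℓ e → degree E ℓ ≤ 1 →
    ∃ λ A → ∃ λ link → ∃ λ B →
      (E ≡ A ++ link ∷ B) × All (Avoids ℓ) A × All (Avoids ℓ) B × incidence ℓ link ≡ 1
  split-at-incident (x ∷ E) e∈ 0<inc deg≤1 with incidence ℓ x in inc≡
  split-at-incident (x ∷ E) (here refl) 0<inc deg≤1 | zero = ⊥-elim (<⇒≱ 0<inc (subst (_≤ 0) (sym inc≡) z≤n))
  split-at-incident (x ∷ E) (there e∈) 0<inc deg≤1 | zero
    with split-at-incident E e∈ 0<inc deg≤1
  ... | A , link , B , E≡ , avoidA , avoidB , inc≡1 =
    x ∷ A , link , B , cong (x ∷_) E≡ , avoids ℓ x inc≡ ∷ avoidA , avoidB , inc≡1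
  split-at-incident (x ∷ E) e∈ 0<inc (s≤s deg≤0) | suc i =
    [] , x , E , refl , [] ,
    avoiding E (n≤0⇒n≡0 (m+n≤o⇒n≤o i deg≤0)) ,
    trans inc≡ (cong suc (n≤0⇒n≡0 (m+n≤o⇒m≤o i deg≤0)))

record Pendant {n} (E : List (Edge n)) : Set where
  field
    leaf stem : Fin n
    stem≢leaf : stem ≢ leaf
    before after : List (Edge n)
    link : Edge n
    link-joins : Joins leaf stem link
    E≡ : E ≡ before ++ link ∷ after
    avoids-before : All (Avoids leaf) before
    avoids-after : All (Avoids leaf) after

-- The handshake count yields a vertex of degree below 2; its degree is
-- positive because the tree is connected and has another vertex.
pendant : ∀ {k} (E : List (Edge (suc (suc k)))) → IsTree E → Pendant E
pendant E (_ , connected , |E|≡) with degree<2-exists E |E|≡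
... | ℓ , deg<2
  with incident-edge (connected ℓ (punchIn ℓ zero)) (punchInᵢ≢i ℓ zero)
... | _ , e∈ , 0<inc
  with split-at-incident ℓ E e∈ 0<inc (s≤s⁻¹ deg<2)
... | A , link , B , E≡ , avoidA , avoidB , inc≡1
  with joins-once ℓ link inc≡1
... | w , w≢ℓ , joins = record
  { leaf = ℓ ; stem = w ; stem≢leaf = w≢ℓ ; before = A ; after = B ; link = link
  ; link-joins = joins ; E≡ = E≡ ; avoids-before = avoidA ; avoids-after = avoidB }

Reach-map : ∀ {m n} {E : List (Edge m)} {F : List (Edge n)} (f : Fin m → Fin n) →
  (∀ {x y} → (x , y) ∈ E → (f x ≡ f y) ⊎ ((f x , f y) ∈ F)) →
  ∀ {x y} → Reach E x y → Reach F (f x) (f y)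
Reach-map f edge here = here
Reach-map {F = F} f edge (fwd xy∈E reach) with edge xy∈E
... | inj₁ fx≡fy = subst (λ z → Reach F z (f _)) (sym fx≡fy) (Reach-map f edge reach)
... | inj₂ fxy∈F = fwd fxy∈F (Reach-map f edge reach)
Reach-map {F = F} f edge (bwd yx∈E reach) with edge yx∈E
... | inj₁ fy≡fx = subst (λ z → Reach F z (f _)) fy≡fx (Reach-map f edge reach)
... | inj₂ fyx∈F = bwd fyx∈F (Reach-map f edge reach)

punchInℕ : ℕ → ℕ → ℕ
punchInℕ zero m = suc m
punchInℕ (suc t) zero = zero
punchInℕ (suc t) (suc m) = suc (punchInℕ t m)

toℕ-punchIn : ∀ {n} (i : Fin (suc n)) k → toℕ (punchIn i k) ≡ punchInℕ (toℕ i) (toℕ k)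
toℕ-punchIn zero k = refl
toℕ-punchIn (suc i) zero = refl
toℕ-punchIn (suc i) (suc k) = cong suc (toℕ-punchIn i k)

punchInℕ-mono-≤ : ∀ t → punchInℕ t Preserves _≤_ ⟶ _≤_
punchInℕ-mono-≤ zero m≤n = s≤s m≤n
punchInℕ-mono-≤ (suc t) {zero} _ = z≤n
punchInℕ-mono-≤ (suc t) {suc m} {suc n} (s≤s m≤n) = s≤s (punchInℕ-mono-≤ t m≤n)

punchInℕ-suc : ∀ m → punchInℕ (suc m) m ≡ m
punchInℕ-suc zero = refl
punchInℕ-suc (suc m) = cong suc (punchInℕ-suc m)

insert-self : ∀ {m} (i j : Fin (suc m)) (π : Arrangement m) → insert i j π ⟨$⟩ʳ i ≡ j
insert-self i j π rewrite proj₂ (dec-yes (i ≟ i) refl) = refl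

-- Removing a leaf, and putting it back next to its stem

module Prune {k} {E : List (Edge (suc (suc k)))} (P : Pendant E) where

  open Pendant P

  -- The leaf goes where its stem goes, so every edge of E becomes an edge of
  -- the pruned tree or a loop, and paths survive contraction.
  contract : Fin (suc (suc k)) → Fin (suc k)
  contract v with leaf ≟ v
  ... | yes _ = punchOut (stem≢leaf ∘ sym)
  ... | no leaf≢v = punchOut leaf≢v

  contract-leaf : contract leaf ≡ contract stem
  contract-leaf with leaf ≟ leaf | leaf ≟ stem
  ... | yes _ | no _ = punchOut-cong leaf refl
  ... | yes _ | yes leaf≡stem = ⊥-elim (stem≢leaf (sym leaf≡stem))
  ... | no leaf≢leaf | _ = ⊥-elim (leaf≢leaf refl)

  contract-punchIn : ∀ a → contract (punchIn leaf a) ≡ a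
  contract-punchIn a with leaf ≟ punchIn leaf a
  ... | yes leaf≡ = ⊥-elim (punchInᵢ≢i leaf a (sym leaf≡))
  ... | no _ = trans (punchOut-cong leaf refl) (punchOut-punchIn leaf)

  punchIn-contract : ∀ v → v ≢ leaf → punchIn leaf (contract v) ≡ v
  punchIn-contract v v≢leaf with leaf ≟ v
  ... | yes leaf≡v = ⊥-elim (v≢leaf (sym leaf≡v))
  ... | no leaf≢v = punchIn-punchOut leaf≢v

  contractEdge : Edge (suc (suc k)) → Edge (suc k)
  contractEdge (a , b) = contract a , contract b

  pruned : List (Edge (suc k))
  pruned = map contractEdge (before ++ after)

  rest-avoids : All (Avoids leaf) (before ++ after)
  rest-avoids = ++⁺ avoids-before avoids-after

  ∈-split : ∀ {e} → e ∈ E → (e ≡ link) ⊎ (e ∈ before ++ after)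
  ∈-split e∈E with ∈-++⁻ before (subst (_ ∈_) E≡ e∈E)
  ... | inj₁ e∈before = inj₂ (∈-++⁺ˡ e∈before)
  ... | inj₂ (here e≡link) = inj₁ e≡link
  ... | inj₂ (there e∈after) = inj₂ (∈-++⁺ʳ before e∈after)

  contract-edge : ∀ {x y} → (x , y) ∈ E → (contract x ≡ contract y) ⊎ ((contract x , contract y) ∈ pruned)
  contract-edge xy∈E with ∈-split xy∈E | link-joins
  ... | inj₁ refl | inj₁ refl = inj₁ contract-leaf
  ... | inj₁ refl | inj₂ refl = inj₁ (sym contract-leaf)
  ... | inj₂ xy∈ | _ = inj₂ (∈-map⁺ contractEdge xy∈)

  pruned-tree : IsTree E → IsTree pruned
  pruned-tree (_ , connected , |E|≡) = s≤s z≤n , connected′ , |pruned|≡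
    where
    connected′ : Connected pruned
    connected′ a b = subst₂ (Reach pruned) (contract-punchIn a) (contract-punchIn b)
      (Reach-map contract contract-edge (connected (punchIn leaf a) (punchIn leaf b)))
    |pruned|≡ : length pruned ≡ k
    |pruned|≡ = begin
      length pruned                         ≡⟨ length-map contractEdge (before ++ after) ⟩
      length (before ++ after)              ≡⟨ length-++ before ⟩
      length before + length after          ≡⟨ suc-injective (begin
        suc (length before + length after)    ≡⟨ sym (+-suc (length before) (length after)) ⟩
        length before + length (link ∷ after) ≡⟨ sym (length-++ before) ⟩
        length (before ++ link ∷ after)       ≡⟨ cong length (sym E≡) ⟩
        length E                              ≡⟨ |E|≡ ⟩
        suc k                                 ∎) ⟩
      k                                     ∎
      where open ≡-Reasoning

  module _ (π′ : Arrangement (suc k)) where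

    extend : Arrangement (suc (suc k))
    extend = insert leaf (suc (π′ ⟨$⟩ʳ contract stem)) π′

    private
      p : ℕ
      p = pos π′ (contract stem)

    pos-old : ∀ v → v ≢ leaf → pos extend v ≡ punchInℕ (suc p) (pos π′ (contract v))
    pos-old v v≢leaf = begin
      toℕ (extend ⟨$⟩ʳ v)                                 ≡⟨ cong (toℕ ∘ (extend ⟨$⟩ʳ_)) (sym (punchIn-contract v v≢leaf)) ⟩
      toℕ (extend ⟨$⟩ʳ punchIn leaf (contract v))          ≡⟨ cong toℕ (insert-punchIn leaf _ π′ (contract v)) ⟩
      toℕ (punchIn (suc (π′ ⟨$⟩ʳ contract stem)) (π′ ⟨$⟩ʳ contract v)) ≡⟨ toℕ-punchIn _ (π′ ⟨$⟩ʳ contract v) ⟩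
      punchInℕ (suc p) (pos π′ (contract v))               ∎
      where open ≡-Reasoning

    pos-leaf : pos extend leaf ≡ suc p
    pos-leaf = cong toℕ (insert-self leaf _ π′)

    pos-stem : pos extend stem ≡ p
    pos-stem = trans (pos-old stem stem≢leaf) (punchInℕ-suc p)

    link-adjacent : Adjacent (pos extend (proj₁ link)) (pos extend (proj₂ link))
    link-adjacent with link | link-joins
    ... | _ | inj₁ refl = subst₂ Adjacent (sym pos-leaf) (sym pos-stem) (adjacentˡ p)
    ... | _ | inj₂ refl = subst₂ Adjacent (sym pos-stem) (sym pos-leaf) (adjacentʳ p)

    old-crossing : ∀ {e f} → e ∈ before ++ after → f ∈ before ++ after →
      Cross extend e f → Cross π′ (contractEdge e) (contractEdge f)
    old-crossing {a , b} {c , d} e∈ f∈ =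
      Crossing-reflect (punchInℕ-mono-≤ (suc p))
        (pos π′ (contract a)) (pos π′ (contract b)) (pos π′ (contract c)) (pos π′ (contract d))
      ∘ Crossing-cong (pos-old a a≢leaf) (pos-old b b≢leaf) (pos-old c c≢leaf) (pos-old d d≢leaf)
      where
      a≢leaf : a ≢ leaf
      a≢leaf = proj₁ (All.lookup rest-avoids e∈)
      b≢leaf : b ≢ leaf
      b≢leaf = proj₂ (All.lookup rest-avoids e∈)
      c≢leaf : c ≢ leaf
      c≢leaf = proj₁ (All.lookup rest-avoids f∈)
      d≢leaf : d ≢ leaf
      d≢leaf = proj₂ (All.lookup rest-avoids f∈)

    extend-planar : Planar pruned π′ → Planar E extend
    extend-planar planar′ (a , b) (c , d) e∈E f∈E with ∈-split e∈E | ∈-split f∈E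
    ... | inj₁ refl | _ = ¬Crossing-adjacentˡ (pos extend c) (pos extend d) link-adjacent
    ... | inj₂ _ | inj₁ refl = ¬Crossing-adjacentʳ (pos extend a) (pos extend b) link-adjacent
    ... | inj₂ e∈ | inj₂ f∈ =
      planar′ _ _ (∈-map⁺ contractEdge e∈) (∈-map⁺ contractEdge f∈) ∘ old-crossing e∈ f∈

  extend-planar-Σ : Σ (Arrangement (suc k)) (Planar pruned) → Σ (Arrangement (suc (suc k))) (Planar E)
  extend-planar-Σ (π′ , planar′) = extend π′ , extend-planar π′ planar′

planar-exists : ∀ {n} (E : List (Edge n)) → IsTree E → Σ (Arrangement n) (Planar E)
planar-exists {zero} E (() , _)
planar-exists {suc zero} [] _ = Permutation.id , λ _ _ ()
planar-exists {suc zero} (_ ∷ _) (_ , _ , ())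
planar-exists {suc (suc k)} E tree = extend-planar-Σ (planar-exists pruned (pruned-tree tree))
  where open Prune (pendant E tree)

-- The leftmost vertex as root

leftmost : ∀ {m} → Arrangement (suc m) → Fin (suc m)
leftmost π = π ⟨$⟩ˡ zero

planar⇒projective-leftmost : ∀ {m} {E : List (Edge (suc m))} π →
  Planar E π → Projective E (leftmost π) π
planar⇒projective-leftmost π planar =
  planar , λ e _ (lo<root , _) → n≮0 (subst (lo π e <_) (cong toℕ (inverseʳ π)) lo<root)

maxPlanar⇒maxProjective : ∀ {m} {E : List (Edge (suc m))} π →
  MaxPlanar E π → MaxProjective E (leftmost π) π
maxPlanar⇒maxProjective π (planar , maximal) =
  planar⇒projective-leftmost π planar , λ σ (planar-σ , _) → maximal σ planar-σ

theorem2 : ∀ {n} (E : List (Edge n)) → IsTree E →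
    (∀ (π : Arrangement n) → MaxPlanar E π → ∃ λ (u : Fin n) → MaxProjective E u π)
    × (Σ ℕ λ d → IsDplMax E d × IsMaxOverRootsDpr E d)
theorem2 {zero} E (() , _)
theorem2 {suc m} E tree =
  (λ π max → leftmost π , maxPlanar⇒maxProjective π max) ,
  cost E best ,
  (best , best-max , refl) ,
  (leftmost best , best , maxPlanar⇒maxProjective best best-max , refl) ,
  projective-bounded
  where
  best,best-max : Σ (Arrangement (suc m)) (MaxPlanar E)
  best,best-max = maxPlanar-exists E (planar-exists E tree)
  best : Arrangement (suc m)
  best = proj₁ best,best-max
  best-max : MaxPlanar E best
  best-max = proj₂ best,best-max
  projective-bounded : ∀ u d′ → IsDprMax E u d′ → d′ ≤ cost E best
  projective-bounded _ _ (σ , ((planar-σ , _) , _) , refl) = proj₂ best-max σ planar-σ
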